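{- Let $n\ge1$ be an integer. Every element of $I_n$ can be written as $[c:d]$ with $c\ge1$ and $c\mid n$. Here $c$ is uniquely determined: if $[c:d]=[c':d']$ with $c,c'\ge1$ dividing $n$, then $c=c'$. The integer $d$ is determined only up to an integer multiple of $n/c$: in that situation $d\equiv d'\pmod{n/c}$. Moreover, the representative can be chosen with $d=ke$, where $e\ge1$, $e\mid n$, $1\le k\le n$, $\gcd(c,e)=1$ and $\gcd(k,n)=1$.
   Context: For $(x,y),(x',y')\in\mathbb Z^2$ write $(x,y)\sim_n(x',y')$ if there is $k\in\mathbb Z$ with $\gcd(k,n)=1$, $kx\equiv x'$ and $ky\equiv y'\pmod n$. $[x:y]$ denotes the class of $(x,y)$. $I_n$ is the set of classes $[c:d]$ such that $(c,d)$ is the bottom row of a matrix in $\mathrm{GL}(2,\mathbb Z)$. Equivalently, it is the set of classes $[x:y]$ with $\gcd(x,y,n)=1$. -}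

module Defs where

open import Data.Nat using (ℕ)
open import Data.Nat.Coprimality using (Coprime)
open import Data.Integer using (ℤ; +_; -_; _*_; _-_; ∣_∣)
open import Data.Integer.Divisibility using (_∣_)
open import Data.Product using (Σ; ∃; _×_; _,_)
open import Data.Sum using (_⊎_)
open import Relation.Binary.PropositionalEquality using (_≡_)

_≡[mod_]_ : ℤ → ℕ → ℤ → Set
a ≡[mod n ] b = (+ n) ∣ (a - b)

-- (x , y) ∼ₙ (x' , y') : ∃ k ∈ ℤ, gcd(k,n)=1, kx ≡ x', ky ≡ y' (mod n).
-- Equality of classes [x:y] = [x':y'] is expressed as (x , y) ∼ₙ (x' , y').
_∼[_]_ : ℤ × ℤ → ℕ → ℤ × ℤ → Set
(x , y) ∼[ n ] (x' , y') =
  ∃ λ (k : ℤ) → Coprime ∣ k ∣ n × ((k * x) ≡[mod n ] x') × ((k * y) ≡[mod n ] y')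

BottomRowGL2 : ℤ × ℤ → Set
BottomRowGL2 (c , d) = ∃ λ (a : ℤ) → ∃ λ (b : ℤ) →
  (a * d - b * c ≡ + 1) ⊎ (a * d - b * c ≡ - (+ 1))

InI : ℕ → ℤ × ℤ → Set
InI n p = ∃ λ (q : ℤ × ℤ) → BottomRowGL2 q × (q ∼[ n ] p)

module Submission where

-- For every x there is a unit K modulo n with K x ≡ gcd(x, n): write x = x′ g and n = m g with
-- gcd(x′, m) = 1, lift x′ to a unit X modulo n by adding w m, where w is the largest divisor of n
-- coprime to x′, and invert X. Applied to x and then to K y this gives [x:y] = [g : k e] with
-- g = gcd(x, n), e = gcd(K y, n) and k a unit in [1, n]. A common divisor of g and e divides n,
-- so it divides the bottom row of the GL(2,ℤ) matrix behind [x:y] and is 1.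
-- Conversely, if k c ≡ c′ with c, c′ ∣ n and k a unit, then c ∣ c′ and c′ ∣ c; and k c ≡ c
-- modulo n = q c forces k ≡ 1 modulo q, so k d ≡ d′ yields d ≡ d′ modulo q.

module Representatives where

  open import Data.Nat.Base as ℕ using (ℕ; zero; suc; z≤n; s≤s; NonZero; NonTrivial)
  import Data.Nat.Properties as ℕ
  import Data.Nat.Divisibility as ℕ
  open import Data.Nat.Coprimality using (Coprime; coprime?; coprime-divisor; coprime-Bézout; gcd≡1⇒coprime; coprime-/gcd)
  open import Data.Nat.DivMod using (_/_; m*n/n≡m; m/n*n≡m)
  open import Data.Nat.GCD using (gcd; gcd[m,n]∣m; gcd[m,n]∣n; gcd[m,n]≢0; module Bézout)
  open import Data.Nat.Induction using (<-rec)
  import Data.Nat.Coprimality as Coprime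
  open import Data.Integer.Base using (ℤ; +_; _+_; _*_; _-_; -_; ∣_∣; 0ℤ; 1ℤ)
  import Data.Integer.Properties as ℤ
  open import Data.Integer.Divisibility.Signed using (_∣_; ∣ᵤ⇒∣; ∣⇒∣ᵤ)
  import Data.Integer.Divisibility.Signed as ℤ
  open import Data.Integer.Tactic.RingSolver using (solve-∀)
  open import Data.Integer.DivMod using (_%ℕ_; _/ℕ_; n%ℕd<d; a≡a%ℕn+[a/ℕn]*n)
  open import Data.Product using (∃; _×_; _,_)
  open import Data.Sum using (_⊎_; inj₁; inj₂)
  open import Relation.Nullary using (yes; no)
  open import Level using (0ℓ)
  open import Relation.Binary.Bundles using (Setoid)
  open import Relation.Binary.PropositionalEquality using (_≡_; refl; sym; trans; cong; subst; subst₂)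
  open import Defs using (_≡[mod_]_; _∼[_]_; BottomRowGL2; InI)

  -- A record, unlike the relation _≡[mod_]_ of Defs (which unfolds to a statement about ∣ a - b ∣),
  -- lets unification recover a, b and n.
  infix 4 _≡_[mod_]
  record _≡_[mod_] (a b : ℤ) (n : ℕ) : Set where
    constructor n∣a-b
    field divides : + n ∣ (a - b)

  ∣abs⇒∣ : ∀ {h} a → h ℕ.∣ ∣ a ∣ → + h ∣ a
  ∣abs⇒∣ {h} a = ∣ᵤ⇒∣ {+ h} {a}

  ≡mod⇒≡[mod] : ∀ {a b n} → a ≡ b [mod n ] → a ≡[mod n ] b
  ≡mod⇒≡[mod] (n∣a-b p) = ∣⇒∣ᵤ p

  ≡[mod]⇒≡mod : ∀ a b n → a ≡[mod n ] b → a ≡ b [mod n ]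
  ≡[mod]⇒≡mod a b n p = n∣a-b (∣ᵤ⇒∣ {+ n} {a - b} p)

  ≡mod-reflexive : ∀ {a b n} → a ≡ b → a ≡ b [mod n ]
  ≡mod-reflexive {a} refl = n∣a-b (subst (_ ∣_) (sym (ℤ.+-inverseʳ a)) (ℤ.∣n⇒∣m*n 0ℤ ℤ.∣-refl))

  ≡mod-sym : ∀ {a b n} → a ≡ b [mod n ] → b ≡ a [mod n ]
  ≡mod-sym {a} {b} (n∣a-b p) = n∣a-b (subst (_ ∣_) (flip a b) (ℤ.∣m⇒∣-m p))
    where
    flip : ∀ a b → - (a - b) ≡ b - a
    flip = solve-∀

  ≡mod-trans : ∀ {a b c n} → a ≡ b [mod n ] → b ≡ c [mod n ] → a ≡ c [mod n ]
  ≡mod-trans {a} {b} {c} (n∣a-b p) (n∣a-b q) = n∣a-b (subst (_ ∣_) (split a b c) (ℤ.∣m∣n⇒∣m+n p q))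
    where
    split : ∀ a b c → (a - b) + (b - c) ≡ a - c
    split = solve-∀

  ≡mod-setoid : ℕ → Setoid 0ℓ 0ℓ
  ≡mod-setoid n = record
    { _≈_ = λ a b → a ≡ b [mod n ]
    ; isEquivalence = record { refl = ≡mod-reflexive refl ; sym = ≡mod-sym ; trans = ≡mod-trans }
    }

  module ≡mod-Reasoning (n : ℕ) where
    open import Relation.Binary.Reasoning.Setoid (≡mod-setoid n) public

  *-cong-≡mod : ∀ {a b c d n} → a ≡ b [mod n ] → c ≡ d [mod n ] → a * c ≡ b * d [mod n ]
  *-cong-≡mod {a} {b} {c} {d} (n∣a-b p) (n∣a-b q) =
    n∣a-b (subst (_ ∣_) (split a b c d) (ℤ.∣m∣n⇒∣m+n (ℤ.∣m⇒∣m*n c p) (ℤ.∣n⇒∣m*n b q)))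
    where
    split : ∀ a b c d → (a - b) * c + b * (c - d) ≡ a * c - b * d
    split = solve-∀

  *-congˡ-≡mod : ∀ {a b n} k → a ≡ b [mod n ] → k * a ≡ k * b [mod n ]
  *-congˡ-≡mod k = *-cong-≡mod {k} {k} (≡mod-reflexive refl)

  *-congʳ-≡mod : ∀ {a b n} k → a ≡ b [mod n ] → a * k ≡ b * k [mod n ]
  *-congʳ-≡mod k a≡b = *-cong-≡mod {c = k} {k} a≡b (≡mod-reflexive refl)

  private
    *-distribʳ-minus : ∀ a b c → (a - b) * c ≡ a * c - b * c
    *-distribʳ-minus = solve-∀

  +-multiple-≡mod : ∀ a t n → a + t * + n ≡ a [mod n ]
  +-multiple-≡mod a t n = n∣a-b (subst (_ ∣_) (sym (cancel a t (+ n))) (ℤ.∣n⇒∣m*n t ℤ.∣-refl))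
    where
    cancel : ∀ a t n → (a + t * n) - a ≡ t * n
    cancel = solve-∀

  modulus≡0-mod : ∀ n → + n ≡ 0ℤ [mod n ]
  modulus≡0-mod n = n∣a-b (subst (+ n ∣_) (sym (ℤ.+-identityʳ (+ n))) ℤ.∣-refl)

  ≡mod-∣ : ∀ {a b m n} → m ℕ.∣ n → a ≡ b [mod n ] → a ≡ b [mod m ]
  ≡mod-∣ {n = n} m∣n (n∣a-b p) = n∣a-b (ℤ.∣-trans (∣abs⇒∣ (+ n) m∣n) p)

  *-scale-≡mod : ∀ {a b m} c → a ≡ b [mod m ] → a * + c ≡ b * + c [mod m ℕ.* c ]
  *-scale-≡mod {a} {b} {m} c (n∣a-b p) =
    n∣a-b (subst₂ _∣_ (sym (ℤ.pos-* m c)) (*-distribʳ-minus a b (+ c)) (ℤ.*-monoˡ-∣ (+ c) p))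

  *-cancelʳ-≡mod : ∀ {a b m} c .{{_ : NonZero c}} → a * + c ≡ b * + c [mod m ℕ.* c ] → a ≡ b [mod m ]
  *-cancelʳ-≡mod {a} {b} {m} c (n∣a-b p) = n∣a-b (ℤ.*-cancelʳ-∣ (+ c)
    (subst₂ _∣_ (ℤ.pos-* m c) (sym (*-distribʳ-minus a b (+ c))) p))

  ∣-resp-≡mod : ∀ {h a b n} → a ≡ b [mod n ] → h ℕ.∣ n → h ℕ.∣ ∣ a ∣ → h ℕ.∣ ∣ b ∣
  ∣-resp-≡mod {h} {a} {b} {n} (n∣a-b p) h∣n h∣a = ∣⇒∣ᵤ (subst (+ h ∣_) (cancel a b)
    (ℤ.∣m∣n⇒∣m-n (∣abs⇒∣ a h∣a) (ℤ.∣-trans (∣abs⇒∣ (+ n) h∣n) p)))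
    where
    cancel : ∀ a b → a - (a - b) ≡ b
    cancel = solve-∀

  coprime-∣ʳ : ∀ {a m n} → Coprime a n → m ℕ.∣ n → Coprime a m
  coprime-∣ʳ a⊥n m∣n (h∣a , h∣m) = a⊥n (h∣a , ℕ.∣-trans h∣m m∣n)

  coprime-* : ∀ {a b n} → Coprime ∣ a ∣ n → Coprime ∣ b ∣ n → Coprime ∣ a * b ∣ n
  coprime-* {a} {b} a⊥n b⊥n (h∣ab , h∣n) =
    b⊥n (coprime-divisor (Coprime.sym (coprime-∣ʳ a⊥n h∣n)) (subst (_ ℕ.∣_) (ℤ.abs-* a b) h∣ab) , h∣n)

  coprime-resp-≡mod : ∀ {a b n} → a ≡ b [mod n ] → Coprime ∣ a ∣ n → Coprime ∣ b ∣ n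
  coprime-resp-≡mod a≡b a⊥n (h∣b , h∣n) = a⊥n (∣-resp-≡mod (≡mod-sym a≡b) h∣n h∣b , h∣n)

  inverse⇒coprime : ∀ {a b n} → b * a ≡ 1ℤ [mod n ] → Coprime ∣ b ∣ n
  inverse⇒coprime {a} {b} ba≡1 (h∣b , h∣n) =
    ℕ.∣1⇒≡1 (∣-resp-≡mod ba≡1 h∣n (subst (_ ℕ.∣_) (sym (ℤ.abs-* b a)) (ℕ.∣m⇒∣m*n ∣ a ∣ h∣b)))

  coprime⇒inverse : ∀ {k n} → Coprime k n → ∃ λ b → b * + k ≡ 1ℤ [mod n ]
  coprime⇒inverse {k} {n} k⊥n with coprime-Bézout k⊥n
  ... | Bézout.+- x y 1+yn≡xk = + x , (begin
    + x * + k          ≡⟨ ℤ.pos-* x k ⟨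
    + (x ℕ.* k)        ≡⟨ cong +_ 1+yn≡xk ⟨
    + (1 ℕ.+ y ℕ.* n)  ≡⟨ cong (λ z → 1ℤ + z) (ℤ.pos-* y n) ⟩
    1ℤ + + y * + n     ≈⟨ +-multiple-≡mod 1ℤ (+ y) n ⟩
    1ℤ                 ∎)
    where open ≡mod-Reasoning n
  ... | Bézout.-+ x y 1+xk≡yn = - + x , (begin
    - + x * + k            ≡⟨ neg-via-1 (+ x) (+ k) ⟩
    1ℤ - (1ℤ + + x * + k)  ≡⟨ cong (λ z → 1ℤ - (1ℤ + z)) (ℤ.pos-* x k) ⟨
    1ℤ - + (1 ℕ.+ x ℕ.* k) ≡⟨ cong (λ z → 1ℤ - + z) 1+xk≡yn ⟩
    1ℤ - + (y ℕ.* n)       ≡⟨ cong (λ z → 1ℤ - z) (ℤ.pos-* y n) ⟩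
    1ℤ - + y * + n         ≡⟨ minus-as-plus (+ y) (+ n) ⟩
    1ℤ + (- + y) * + n     ≈⟨ +-multiple-≡mod 1ℤ (- + y) n ⟩
    1ℤ                     ∎)
    where
    open ≡mod-Reasoning n
    neg-via-1 : ∀ x k → - x * k ≡ 1ℤ - (1ℤ + x * k)
    neg-via-1 = solve-∀
    minus-as-plus : ∀ y n → 1ℤ - y * n ≡ 1ℤ + (- y) * n
    minus-as-plus = solve-∀

  positive-residue : ∀ a n .{{_ : NonZero n}} → ∃ λ k → 1 ℕ.≤ k × k ℕ.≤ n × a ≡ + k [mod n ]
  positive-residue a n = residue (a %ℕ n) (n%ℕd<d a n) (begin
    a                          ≡⟨ a≡a%ℕn+[a/ℕn]*n a n ⟩
    + (a %ℕ n) + (a /ℕ n) * + n ≈⟨ +-multiple-≡mod (+ (a %ℕ n)) (a /ℕ n) n ⟩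
    + (a %ℕ n)                 ∎)
    where
    open ≡mod-Reasoning n
    residue : ∀ r → r ℕ.< n → a ≡ + r [mod n ] → ∃ λ k → 1 ℕ.≤ k × k ℕ.≤ n × a ≡ + k [mod n ]
    residue zero    _   a≡0 = n , ℕ.>-nonZero⁻¹ n , ℕ.≤-refl , ≡mod-trans a≡0 (≡mod-sym (modulus≡0-mod n))
    residue (suc r) r<n a≡r = suc r , s≤s z≤n , ℕ.<⇒≤ r<n , a≡r

  unit-residue : ∀ {a n} .{{_ : NonZero n}} → Coprime ∣ a ∣ n →
                 ∃ λ k → 1 ℕ.≤ k × k ℕ.≤ n × Coprime k n × a ≡ + k [mod n ]
  unit-residue {a} {n} a⊥n with positive-residue a n
  ... | k , 1≤k , k≤n , a≡k = k , 1≤k , k≤n , coprime-resp-≡mod a≡k a⊥n , a≡k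

  unit-inverse : ∀ {a n} .{{_ : NonZero n}} → Coprime ∣ a ∣ n → ∃ λ b → Coprime ∣ b ∣ n × b * a ≡ 1ℤ [mod n ]
  unit-inverse {a} {n} a⊥n with unit-residue a⊥n
  ... | k , _ , _ , k⊥n , a≡k with coprime⇒inverse k⊥n
  ... | b , bk≡1 = b , inverse⇒coprime {a} {b} ba≡1 , ba≡1
    where
    ba≡1 : b * a ≡ 1ℤ [mod n ]
    ba≡1 = ≡mod-trans (*-congˡ-≡mod b a≡k) bk≡1

  MaximalCoprimeDivisor : ℕ → ℕ → ℕ → Set
  MaximalCoprimeDivisor a n w = w ℕ.∣ n × Coprime w a × (∀ {g} → g ℕ.∣ n → Coprime g a → g ℕ.∣ w)

  maximal-coprime-divisor : ∀ a n .{{_ : NonZero n}} → ∃ (MaximalCoprimeDivisor a n)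
  maximal-coprime-divisor a = <-rec P step
    where
    P : ℕ → Set
    P n = .{{NonZero n}} → ∃ (MaximalCoprimeDivisor a n)

    step : ∀ n → (∀ {m} → m ℕ.< n → P m) → P n
    step n rec with coprime? n a
    ... | yes n⊥a = n , ℕ.∣-refl , n⊥a , λ g∣n _ → g∣n
    ... | no ¬n⊥a = descend (gcd[m,n]∣m n a) (gcd[m,n]∣n n a)
      where
      instance
        gcd>1 : NonTrivial (gcd n a)
        gcd>1 = ℕ.n>1⇒nonTrivial (ℕ.≤∧≢⇒< (ℕ.n≢0⇒n>0 (gcd[m,n]≢0 n a (inj₁ (ℕ.≢-nonZero⁻¹ n))))
                                           (λ 1≡gcd → ¬n⊥a (gcd≡1⇒coprime (sym 1≡gcd))))

      descend : ∀ {d} .{{_ : NonTrivial d}} (d∣n : d ℕ.∣ n) → d ℕ.∣ a → ∃ (MaximalCoprimeDivisor a n)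
      descend d∣n d∣a =
        let w , w∣n/d , w⊥a , maximal = rec (ℕ.quotient-< d∣n) {{ℕ.quotient≢0 d∣n}}
            n≡d*[n/d] = ℕ.m∣n⇒n≡m*quotient d∣n
        in w , ℕ.∣-trans w∣n/d (ℕ.quotient-∣ d∣n) , w⊥a ,
           λ g∣n g⊥a → maximal (coprime-divisor (coprime-∣ʳ g⊥a d∣a) (subst (_ ℕ.∣_) n≡d*[n/d] g∣n)) g⊥a

  unit-lift : ∀ {u m n} .{{_ : NonZero n}} → Coprime ∣ u ∣ m → ∃ λ v → Coprime ∣ v ∣ n × v ≡ u [mod m ]
  unit-lift {u} {m} {n} u⊥m with maximal-coprime-divisor ∣ u ∣ n
  ... | w , _ , w⊥u , maximal = u + + w * + m , v⊥n , +-multiple-≡mod u (+ w) m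
    where
    wm⊥u : Coprime ∣ + w * + m ∣ ∣ u ∣
    wm⊥u = coprime-* {+ w} {+ m} w⊥u (Coprime.sym u⊥m)

    v⊥n : Coprime ∣ u + + w * + m ∣ n
    v⊥n {h} (h∣v , h∣n) = h⊥u (ℕ.∣-refl , ∣⇒∣ᵤ (ℤ.∣m+n∣n⇒∣m {m = u} (∣abs⇒∣ (u + + w * + m) h∣v) h∣wm))
      where
      h⊥u : Coprime h ∣ u ∣
      h⊥u (e∣h , e∣u) = wm⊥u (∣⇒∣ᵤ (ℤ.∣m+n∣m⇒∣n (∣abs⇒∣ (u + + w * + m) (ℕ.∣-trans e∣h h∣v))
                                                (∣abs⇒∣ u e∣u)) , e∣u)
      h∣wm : + h ∣ + w * + m
      h∣wm = ℤ.∣m⇒∣m*n (+ m) (∣abs⇒∣ (+ w) (maximal h∣n h⊥u))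

  gcd-nonZero : ∀ m n .{{_ : NonZero n}} → NonZero (gcd m n)
  gcd-nonZero m n = ℕ.≢-nonZero (gcd[m,n]≢0 m n (inj₂ (ℕ.≢-nonZero⁻¹ n)))

  -- Opaque: unfolding this witness makes the type checker evaluate gcd and the well-founded
  -- recursion behind unit-lift, which exhausts memory.
  opaque
    ≡unit*gcd : ∀ x n .{{_ : NonZero n}} → ∃ λ X → Coprime ∣ X ∣ n × x ≡ X * + gcd ∣ x ∣ n [mod n ]
    ≡unit*gcd x n = conclude (unit-lift x′⊥n/g)
      where
      g : ℕ
      g = gcd ∣ x ∣ n
      instance
        g≢0 : NonZero g
        g≢0 = gcd-nonZero ∣ x ∣ n

      open ℤ._∣_ (∣abs⇒∣ x (gcd[m,n]∣m ∣ x ∣ n)) renaming (quotient to x′; equality to x≡x′g)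

      ∣x′∣≡∣x∣/g : ∣ x′ ∣ ≡ ∣ x ∣ / g
      ∣x′∣≡∣x∣/g = sym (trans (cong (λ z → ∣ z ∣ / g) x≡x′g)
                             (trans (cong (_/ g) (ℤ.abs-* x′ (+ g))) (m*n/n≡m ∣ x′ ∣ g)))

      x′⊥n/g : Coprime ∣ x′ ∣ (n / g)
      x′⊥n/g = subst (λ z → Coprime z (n / g)) (sym ∣x′∣≡∣x∣/g) (coprime-/gcd ∣ x ∣ n)

      conclude : (∃ λ X → Coprime ∣ X ∣ n × X ≡ x′ [mod n / g ]) →
                 ∃ λ X → Coprime ∣ X ∣ n × x ≡ X * + g [mod n ]
      conclude (X , X⊥n , X≡x′) = X , X⊥n , subst (λ k → x ≡ X * + g [mod k ]) n/g*g≡n (begin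
        x          ≡⟨ x≡x′g ⟩
        x′ * + g   ≈⟨ *-scale-≡mod g (≡mod-sym X≡x′) ⟩
        X * + g    ∎)
        where
        open ≡mod-Reasoning (n / g ℕ.* g)
        n/g*g≡n : n / g ℕ.* g ≡ n
        n/g*g≡n = m/n*n≡m (gcd[m,n]∣n ∣ x ∣ n)

  unit*≡ : ∀ {x X g n} .{{_ : NonZero n}} → Coprime ∣ X ∣ n → x ≡ X * g [mod n ] →
           ∃ λ K → Coprime ∣ K ∣ n × K * x ≡ g [mod n ]
  unit*≡ {x} {X} {g} {n} X⊥n x≡Xg =
    let K , K⊥n , KX≡1 = unit-inverse {X} X⊥n in K , K⊥n , (begin
    K * x         ≈⟨ *-congˡ-≡mod K x≡Xg ⟩
    K * (X * g)   ≡⟨ ℤ.*-assoc K X g ⟨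
    K * X * g     ≈⟨ *-congʳ-≡mod g KX≡1 ⟩
    1ℤ * g        ≡⟨ ℤ.*-identityˡ g ⟩
    g             ∎)
    where open ≡mod-Reasoning n

  unit*≡gcd : ∀ x n .{{_ : NonZero n}} → ∃ λ K → Coprime ∣ K ∣ n × K * x ≡ + gcd ∣ x ∣ n [mod n ]
  unit*≡gcd x n = let X , X⊥n , x≡Xg = ≡unit*gcd x n in unit*≡ {x} {X} X⊥n x≡Xg

  ∼-trans : ∀ {p q r n} → p ∼[ n ] q → q ∼[ n ] r → p ∼[ n ] r
  ∼-trans {x , y} {x′ , y′} {x″ , y″} {n} (j , j⊥n , jx≡x′ , jy≡y′) (k , k⊥n , kx′≡x″ , ky′≡y″) =
    k * j , coprime-* {k} {j} k⊥n j⊥n , compose x x′ x″ jx≡x′ kx′≡x″ , compose y y′ y″ jy≡y′ ky′≡y″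
    where
    compose : ∀ a a′ a″ → (j * a) ≡[mod n ] a′ → (k * a′) ≡[mod n ] a″ → (k * j * a) ≡[mod n ] a″
    compose a a′ a″ ja≡a′ ka′≡a″ = ≡mod⇒≡[mod] (begin
      k * j * a     ≡⟨ ℤ.*-assoc k j a ⟩
      k * (j * a)   ≈⟨ *-congˡ-≡mod k (≡[mod]⇒≡mod (j * a) a′ n ja≡a′) ⟩
      k * a′        ≈⟨ ≡[mod]⇒≡mod (k * a′) a″ n ka′≡a″ ⟩
      a″            ∎)
      where open ≡mod-Reasoning n

  ∼-intro : ∀ {x′ y′ n} x y k → Coprime ∣ k ∣ n → k * x ≡ x′ [mod n ] → k * y ≡ y′ [mod n ] →
            (x , y) ∼[ n ] (x′ , y′)
  ∼-intro x y k k⊥n kx≡x′ ky≡y′ = k , k⊥n , ≡mod⇒≡[mod] kx≡x′ , ≡mod⇒≡[mod] ky≡y′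

  InI-∼ : ∀ {p q n} → InI n p → p ∼[ n ] q → InI n q
  InI-∼ (r , r∈GL₂ , r∼p) p∼q = r , r∈GL₂ , ∼-trans r∼p p∼q

  BottomRowGL2⇒coprime : ∀ {c d} → BottomRowGL2 (c , d) → Coprime ∣ c ∣ ∣ d ∣
  BottomRowGL2⇒coprime {c} {d} (a , b , det≡±1) {h} (h∣c , h∣d) = ℕ.∣1⇒≡1 (h∣±1 det≡±1)
    where
    h∣det : + h ∣ a * d - b * c
    h∣det = ℤ.∣m∣n⇒∣m-n (ℤ.∣n⇒∣m*n a (∣abs⇒∣ d h∣d)) (ℤ.∣n⇒∣m*n b (∣abs⇒∣ c h∣c))
    h∣±1 : (a * d - b * c ≡ + 1) ⊎ (a * d - b * c ≡ - (+ 1)) → h ℕ.∣ 1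
    h∣±1 (inj₁ det≡1)  = ∣⇒∣ᵤ (subst (+ h ∣_) det≡1 h∣det)
    h∣±1 (inj₂ det≡-1) = ∣⇒∣ᵤ (subst (+ h ∣_) det≡-1 h∣det)

  InI⇒common-divisor≡1 : ∀ {x y n h} → InI n (x , y) → h ℕ.∣ n → h ℕ.∣ ∣ x ∣ → h ℕ.∣ ∣ y ∣ → h ≡ 1
  InI⇒common-divisor≡1 {x} {y} {n} {h} ((c , d) , cd∈GL₂ , (j , j⊥n , jc≡x , jd≡y)) h∣n h∣x h∣y =
    BottomRowGL2⇒coprime cd∈GL₂ (cancel-unit c jc≡x h∣x , cancel-unit d jd≡y h∣y)
    where
    h⊥j : Coprime h ∣ j ∣
    h⊥j = Coprime.sym (coprime-∣ʳ j⊥n h∣n)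
    cancel-unit : ∀ a {b} → (j * a) ≡[mod n ] b → h ℕ.∣ ∣ b ∣ → h ℕ.∣ ∣ a ∣
    cancel-unit a {b} ja≡b h∣b = coprime-divisor h⊥j (subst (h ℕ.∣_) (ℤ.abs-* j a)
      (∣-resp-≡mod (≡mod-sym (≡[mod]⇒≡mod (j * a) b n ja≡b)) h∣n h∣b))

  ∼-first-unique : ∀ {c c′ d d′ n} → c ℕ.∣ n → c′ ℕ.∣ n → (+ c , d) ∼[ n ] (+ c′ , d′) → c ≡ c′
  ∼-first-unique {c} {c′} {n = n} c∣n c′∣n (k , k⊥n , kc≡c′ , _) = ℕ.∣-antisym c∣c′ c′∣c
    where
    kc≡c′[n] : k * + c ≡ + c′ [mod n ]
    kc≡c′[n] = ≡[mod]⇒≡mod (k * + c) (+ c′) n kc≡c′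
    ∣kc∣≡∣k∣c : ∣ k * + c ∣ ≡ ∣ k ∣ ℕ.* c
    ∣kc∣≡∣k∣c = ℤ.abs-* k (+ c)
    c∣c′ : c ℕ.∣ c′
    c∣c′ = ∣-resp-≡mod kc≡c′[n] c∣n (subst (c ℕ.∣_) (sym ∣kc∣≡∣k∣c) (ℕ.n∣m*n ∣ k ∣))
    c′∣c : c′ ℕ.∣ c
    c′∣c = coprime-divisor (Coprime.sym (coprime-∣ʳ k⊥n c′∣n))
      (subst (c′ ℕ.∣_) ∣kc∣≡∣k∣c (∣-resp-≡mod (≡mod-sym kc≡c′[n]) c′∣n ℕ.∣-refl))

  ∼-second-≡mod : ∀ {c d d′ n} q .{{_ : NonZero c}} → n ≡ q ℕ.* c →
                  (+ c , d) ∼[ n ] (+ c , d′) → d ≡ d′ [mod q ]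
  ∼-second-≡mod {c} {d} {d′} {n} q n≡qc (k , _ , kc≡c , kd≡d′) = begin
    d        ≡⟨ ℤ.*-identityˡ d ⟨
    1ℤ * d   ≈⟨ *-congʳ-≡mod d (≡mod-sym k≡1) ⟩
    k * d    ≈⟨ ≡mod-∣ q∣n (≡[mod]⇒≡mod (k * d) d′ n kd≡d′) ⟩
    d′       ∎
    where
    open ≡mod-Reasoning q
    q∣n : q ℕ.∣ n
    q∣n = subst (q ℕ.∣_) (sym n≡qc) (ℕ.m∣m*n c)
    kc≡1c : k * + c ≡ 1ℤ * + c [mod q ℕ.* c ]
    kc≡1c = subst (λ m → k * + c ≡ 1ℤ * + c [mod m ]) n≡qc
      (≡mod-trans (≡[mod]⇒≡mod (k * + c) (+ c) n kc≡c) (≡mod-reflexive (sym (ℤ.*-identityˡ (+ c)))))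
    k≡1 : k ≡ 1ℤ [mod q ]
    k≡1 = *-cancelʳ-≡mod c kc≡1c

  InI⇒coprime : ∀ {c d n} → InI n (+ c , + d) → c ℕ.∣ n → Coprime c d
  InI⇒coprime cd∈I c∣n (h∣c , h∣d) = InI⇒common-divisor≡1 cd∈I (ℕ.∣-trans h∣c c∣n) h∣c h∣d

  InI-normal-form : ∀ {n} .{{_ : NonZero n}} (x y : ℤ) → InI n (x , y) →
    ∃ λ (c : ℕ) → ∃ λ (e : ℕ) → ∃ λ (k : ℕ) →
      1 ℕ.≤ c × c ℕ.∣ n × 1 ℕ.≤ e × e ℕ.∣ n × 1 ℕ.≤ k × k ℕ.≤ n ×
      Coprime c e × Coprime k n × ((x , y) ∼[ n ] (+ c , + (k ℕ.* e)))
  InI-normal-form {n} x y xy∈I =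
    let K , K⊥n , Kx≡g = unit*≡gcd x n
        X , X⊥n , Ky≡Xe = ≡unit*gcd (K * y) n
        k , 1≤k , k≤n , k⊥n , X≡k = unit-residue {X} X⊥n
        g = gcd ∣ x ∣ n
        e = gcd ∣ K * y ∣ n
        Ky≡ke : K * y ≡ + (k ℕ.* e) [mod n ]
        Ky≡ke = ≡mod-trans Ky≡Xe (≡mod-trans (*-congʳ-≡mod (+ e) X≡k) (≡mod-reflexive (sym (ℤ.pos-* k e))))
        xy∼gke : (x , y) ∼[ n ] (+ g , + (k ℕ.* e))
        xy∼gke = ∼-intro x y K K⊥n Kx≡g Ky≡ke
        g⊥ke = InI⇒coprime (InI-∼ xy∈I xy∼gke) (gcd[m,n]∣n ∣ x ∣ n)
    in g , e , k , 1≤gcd (∣ x ∣) , gcd[m,n]∣n (∣ x ∣) n , 1≤gcd (∣ K * y ∣) , gcd[m,n]∣n (∣ K * y ∣) n ,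
       1≤k , k≤n , coprime-∣ʳ g⊥ke (ℕ.n∣m*n k) , k⊥n , xy∼gke
    where
    1≤gcd : ∀ m → 1 ℕ.≤ gcd m n
    1≤gcd m = ℕ.>-nonZero⁻¹ (gcd m n) {{gcd-nonZero m n}}

  InI-representative : ∀ {n} .{{_ : NonZero n}} (x y : ℤ) → InI n (x , y) →
    ∃ λ (c : ℕ) → ∃ λ (d : ℤ) → 1 ℕ.≤ c × c ℕ.∣ n × ((x , y) ∼[ n ] (+ c , d))
  InI-representative x y xy∈I =
    let c , e , k , 1≤c , c∣n , _ , _ , _ , _ , _ , _ , xy∼cke = InI-normal-form x y xy∈I
    in c , + (k ℕ.* e) , 1≤c , c∣n , xy∼cke

  representative-unique : ∀ {c c′ n} {d d′ : ℤ} .{{_ : NonZero c}} → c ℕ.∣ n → c′ ℕ.∣ n →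
    (+ c , d) ∼[ n ] (+ c′ , d′) → c ≡ c′ × ((q : ℕ) → n ≡ q ℕ.* c → d ≡[mod q ] d′)
  representative-unique {c} {c′} {n} {d} {d′} c∣n c′∣n cd∼c′d′ = c≡c′ , λ q n≡qc →
    ≡mod⇒≡[mod] (∼-second-≡mod q n≡qc (subst (λ z → (+ c , d) ∼[ n ] (+ z , d′)) (sym c≡c′) cd∼c′d′))
    where
    c≡c′ : c ≡ c′
    c≡c′ = ∼-first-unique c∣n c′∣n cd∼c′d′

open import Defs
open import Data.Nat using (ℕ; _≤_; _*_)
open import Data.Nat.Divisibility using (_∣_)
open import Data.Nat.Coprimality using (Coprime)
open import Data.Integer using (ℤ; +_)
open import Data.Product using (∃; _×_; _,_)
open import Relation.Binary.PropositionalEquality using (_≡_)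
open import Data.Nat.Base using (NonZero; >-nonZero)
open Representatives using (InI-representative; representative-unique; InI-normal-form)

proposition5p4 : (n : ℕ) → 1 ≤ n →
  -- existence: [x:y] = [c:d] with c ≥ 1, c ∣ n
  ((x y : ℤ) → InI n (x , y) →
    ∃ λ (c : ℕ) → ∃ λ (d : ℤ) → 1 ≤ c × c ∣ n × ((x , y) ∼[ n ] (+ c , d)))
  -- uniqueness: c is unique, d unique modulo n / c
  × ((c c' : ℕ) (d d' : ℤ) → 1 ≤ c → c ∣ n → 1 ≤ c' → c' ∣ n →
      InI n (+ c , d) → ((+ c , d) ∼[ n ] (+ c' , d')) →
      (c ≡ c') × ((q : ℕ) → n ≡ q * c → d ≡[mod q ] d'))
  -- moreover: representative with d = k e
  × ((x y : ℤ) → InI n (x , y) →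
    ∃ λ (c : ℕ) → ∃ λ (e : ℕ) → ∃ λ (k : ℕ) →
      1 ≤ c × c ∣ n × 1 ≤ e × e ∣ n × 1 ≤ k × k ≤ n ×
      Coprime c e × Coprime k n ×
      ((x , y) ∼[ n ] (+ c , + (k * e))))
proposition5p4 n 1≤n =
  InI-representative ,
  (λ c c' d d' 1≤c c∣n _ c'∣n _ → representative-unique {{>-nonZero 1≤c}} c∣n c'∣n) ,
  InI-normal-form
  where
  instance
    n≢0 : NonZero n
    n≢0 = >-nonZero 1≤n
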